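{- (Subject reduction for $\beta$.) If $M:\langle\Gamma\vdash U\rangle$ and $M\rhd_\beta^* N$, then $N:\langle\Gamma\restriction_N\vdash U\rangle$.
   Context: Terms: $\mathcal V$ is a denumerably infinite set of variables; $\mathcal M$ is the set of untyped $\lambda$-terms $M::=x\mid \lambda x.M\mid MM$ taken modulo $\alpha$-conversion; $FV(M)$ is the set of free variables; $M[x:=N]$ is capture-avoiding substitution. $\rhd_\beta$ is the compatible closure of $(\lambda x.M)N\rhd_\beta M[x:=N]$ and $\rhd_\beta^*$ its reflexive-transitive closure. Types: $\mathcal A$ is a denumerably infinite set of atomic types; $\mathbb T::=a\mid \mathbb U\to\mathbb T$ ($a\in\mathcal A$) and $\mathbb U::=\omega\mid \mathbb U\sqcap\mathbb U\mid \mathbb T$; types are quotiented by commutativity, associativity and idempotence of $\sqcap$ and by $\omega\sqcap U=U$. $T$ ranges over $\mathbb T$, $U,V$ over $\mathbb U$. Environments: a type environment is a finite set $(x_i:U_i)_n$ of declarations with pairwise distinct variables; $dom$ is its set of variables; $()$ is the empty environment; $\Gamma,x:U$ requires $x\notin dom(\Gamma)$; $env^M_\omega$ assigns $\omega$ to each variable of $FV(M)$ and nothing else; if $\Gamma_1=(x_i:U_i)_n,(y_j:V_j)_m$ and $\Gamma_2=(x_i:U'_i)_n,(z_k:W_k)_l$ with the $y_j$, $z_k$ all distinct, then $\Gamma_1\sqcap\Gamma_2=(x_i:U_i\sqcap U'_i)_n,(y_j:V_j)_m,(z_k:W_k)_l$. For $\mathcal U\subseteq dom(\Gamma)$, $\Gamma\restriction_{\mathcal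 U}$ is the restriction of $\Gamma$ to the variables in $\mathcal U$, and $\Gamma\restriction_N$ means $\Gamma\restriction_{FV(N)}$. Subtyping: $\sqsubseteq$ (on types, on environments, and on typings $\langle\Gamma\vdash U\rangle$) is the least relation closed under: $\Phi\sqsubseteq\Phi$; transitivity; $U_1\sqcap U_2\sqsubseteq U_1$; if $U_1\sqsubseteq V_1$ and $U_2\sqsubseteq V_2$ then $U_1\sqcap U_2\sqsubseteq V_1\sqcap V_2$; if $U_2\sqsubseteq U_1$ and $T_1\sqsubseteq T_2$ then $U_1\to T_1\sqsubseteq U_2\to T_2$; if $U_1\sqsubseteq U_2$ and $x\notin dom(\Gamma)$ then $\Gamma,x:U_1\sqsubseteq\Gamma,x:U_2$; if $U_1\sqsubseteq U_2$ and $\Gamma_2\sqsubseteq\Gamma_1$ then $\langle\Gamma_1\vdash U_1\rangle\sqsubseteq\langle\Gamma_2\vdash U_2\rangle$. Typing rules for $M:\langle\Gamma\vdash U\rangle$: (ax) $x:\langle x:T\vdash T\rangle$ for $T\in\mathbb T$; ($\omega$) $M:\langle env^M_\omega\vdash\omega\rangle$; ($\to_i$) from $M:\langle\Gamma,x:U\vdash T\rangle$ infer $\lambda x.M:\langle\Gamma\vdash U\to T\rangle$; ($\to'_i$) from $M:\langle\Gamma\vdash T\rangle$ and $x\notin dom(\Gamma)$ infer $\lambda x.M:\langle\Gamma\vdash\omega\to T\rangle$; ($\to_e$) from $M_1:\langle\Gamma_1\vdash U\to T\rangle$ and $M_2:\langle\Gamma_2\vdash U\rangle$ infer $M_1M_2:\langle\Gamma_1\sqcap\Gamma_2\vdash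 T\rangle$; ($\sqcap_i$) from $M:\langle\Gamma\vdash U_1\rangle$ and $M:\langle\Gamma\vdash U_2\rangle$ infer $M:\langle\Gamma\vdash U_1\sqcap U_2\rangle$; ($\sqsubseteq$) from $M:\langle\Gamma\vdash U\rangle$ and $\langle\Gamma\vdash U\rangle\sqsubseteq\langle\Gamma'\vdash U'\rangle$ infer $M:\langle\Gamma'\vdash U'\rangle$. -}

module Defs where

open import Data.Nat using (ℕ; zero; suc)
open import Data.Fin using (Fin; zero; suc; _≟_)
open import Data.Bool using (Bool; true; false; _∨_; if_then_else_)
open import Data.Maybe using (Maybe; just; nothing)
open import Relation.Nullary.Decidable using (⌊_⌋)
open import Relation.Binary.Construct.Closure.ReflexiveTransitive using (Star)

-- λ-terms modulo α-conversion: well-scoped de Bruijn terms.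
-- A term of type Tm n has its free variables among Fin n.

data Tm (n : ℕ) : Set where
  var : Fin n → Tm n
  lam : Tm (suc n) → Tm n
  app : Tm n → Tm n → Tm n

ext : ∀ {m n} → (Fin m → Fin n) → Fin (suc m) → Fin (suc n)
ext ρ zero    = zero
ext ρ (suc i) = suc (ρ i)

rename : ∀ {m n} → (Fin m → Fin n) → Tm m → Tm n
rename ρ (var i)   = var (ρ i)
rename ρ (lam M)   = lam (rename (ext ρ) M)
rename ρ (app M N) = app (rename ρ M) (rename ρ N)

exts : ∀ {m n} → (Fin m → Tm n) → Fin (suc m) → Tm (suc n)
exts σ zero    = var zero
exts σ (suc i) = rename suc (σ i)

subst : ∀ {m n} → (Fin m → Tm n) → Tm m → Tm n
subst σ (var i)   = σ i
subst σ (lam M)   = lam (subst (exts σ) M)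
subst σ (app M N) = app (subst σ M) (subst σ N)

-- M [ N ] is  M[x:=N]  where x is the variable bound by the enclosing λ
subst₀ : ∀ {n} → Tm n → Fin (suc n) → Tm n
subst₀ N zero    = N
subst₀ N (suc i) = var i

_[_] : ∀ {n} → Tm (suc n) → Tm n → Tm n
M [ N ] = subst (subst₀ N) M

occurs : ∀ {n} → Fin n → Tm n → Bool
occurs i (var j)   = ⌊ i ≟ j ⌋
occurs i (lam M)   = occurs (suc i) M
occurs i (app M N) = occurs i M ∨ occurs i N

data _▷β_ {n : ℕ} : Tm n → Tm n → Set where
  β    : ∀ {M : Tm (suc n)} {N : Tm n} → app (lam M) N ▷β (M [ N ])
  ξlam : ∀ {M M′ : Tm (suc n)} → M ▷β M′ → lam M ▷β lam M′
  ξappˡ : ∀ {M M′ N : Tm n} → M ▷β M′ → app M N ▷β app M′ N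
  ξappʳ : ∀ {M N N′ : Tm n} → N ▷β N′ → app M N ▷β app M N′

_▷β*_ : ∀ {n} → Tm n → Tm n → Set
_▷β*_ = Star _▷β_

mutual
  data TT : Set where
    atom : ℕ → TT
    _⇒_  : UU → TT → TT

  data UU : Set where
    ω   : UU
    _⊓_ : UU → UU → UU
    ⌜_⌝ : TT → UU

infixr 7 _⇒_
infixl 6 _⊓_

-- the quotient: congruence generated by commutativity, associativity,
-- idempotence of ⊓ and ω ⊓ U = U
data _≅_ : UU → UU → Set where
  ≅-refl  : ∀ {U} → U ≅ U
  ≅-sym   : ∀ {U V} → U ≅ V → V ≅ U
  ≅-trans : ∀ {U V W} → U ≅ V → V ≅ W → U ≅ W
  ⊓-comm  : ∀ {U V} → (U ⊓ V) ≅ (V ⊓ U)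
  ⊓-assoc : ∀ {U V W} → ((U ⊓ V) ⊓ W) ≅ (U ⊓ (V ⊓ W))
  ⊓-idem  : ∀ {U} → (U ⊓ U) ≅ U
  ⊓-unit  : ∀ {U} → (ω ⊓ U) ≅ U
  ⊓-cong  : ∀ {U U′ V V′} → U ≅ U′ → V ≅ V′ → (U ⊓ V) ≅ (U′ ⊓ V′)
  ⇒-cong  : ∀ {U U′ T T′} → U ≅ U′ → ⌜ T ⌝ ≅ ⌜ T′ ⌝ → ⌜ U ⇒ T ⌝ ≅ ⌜ U′ ⇒ T′ ⌝

-- subtyping on types (on equivalence classes: reflexivity is up to ≅)
data _⊑_ : UU → UU → Set where
  ⊑-refl  : ∀ {U V} → U ≅ V → U ⊑ V
  ⊑-trans : ∀ {U V W} → U ⊑ V → V ⊑ W → U ⊑ W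
  ⊑-⊓     : ∀ {U₁ U₂} → (U₁ ⊓ U₂) ⊑ U₁
  ⊑-⊓-mono : ∀ {U₁ U₂ V₁ V₂} → U₁ ⊑ V₁ → U₂ ⊑ V₂ → (U₁ ⊓ U₂) ⊑ (V₁ ⊓ V₂)
  ⊑-⇒     : ∀ {U₁ U₂ T₁ T₂} → U₂ ⊑ U₁ → ⌜ T₁ ⌝ ⊑ ⌜ T₂ ⌝ → ⌜ U₁ ⇒ T₁ ⌝ ⊑ ⌜ U₂ ⇒ T₂ ⌝

-- Environments over the scope Fin n: Γ i = just U  iff  (i : U) ∈ Γ.

Env : ℕ → Set
Env n = Fin n → Maybe UU

-- Γ , x : U  (x the fresh variable bound by a λ, i.e. index zero)
_▸_ : ∀ {n} → Env n → Maybe UU → Env (suc n)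
(Γ ▸ u) zero    = u
(Γ ▸ u) (suc i) = Γ i

single : ∀ {n} → Fin n → UU → Env n
single x U i = if ⌊ i ≟ x ⌋ then just U else nothing

envω : ∀ {n} → Tm n → Env n
envω M i = if occurs i M then just ω else nothing

_⊓ₑ_ : ∀ {n} → Env n → Env n → Env n
(Γ₁ ⊓ₑ Γ₂) i with Γ₁ i | Γ₂ i
... | just U  | just V  = just (U ⊓ V)
... | just U  | nothing = just U
... | nothing | just V  = just V
... | nothing | nothing = nothing

_↾_ : ∀ {n} → Env n → Tm n → Env n
(Γ ↾ N) i = if occurs i N then Γ i else nothing

data _⊑ₘ_ : Maybe UU → Maybe UU → Set where
  nothing⊑ : nothing ⊑ₘ nothing
  just⊑    : ∀ {U V} → U ⊑ V → just U ⊑ₘ just V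

_⊑ₑ_ : ∀ {n} → Env n → Env n → Set
Γ ⊑ₑ Γ′ = ∀ i → Γ i ⊑ₘ Γ′ i

data _⦂⟨_⊢_⟩ {n : ℕ} : Tm n → Env n → UU → Set where
  ax   : (x : Fin n) (T : TT) → var x ⦂⟨ single x ⌜ T ⌝ ⊢ ⌜ T ⌝ ⟩
  ω-ty : (M : Tm n) → M ⦂⟨ envω M ⊢ ω ⟩
  →i   : ∀ {Γ U T} {M : Tm (suc n)} →
         M ⦂⟨ Γ ▸ just U ⊢ ⌜ T ⌝ ⟩ → lam M ⦂⟨ Γ ⊢ ⌜ U ⇒ T ⌝ ⟩
  →i′  : ∀ {Γ T} {M : Tm (suc n)} →
         M ⦂⟨ Γ ▸ nothing ⊢ ⌜ T ⌝ ⟩ → lam M ⦂⟨ Γ ⊢ ⌜ ω ⇒ T ⌝ ⟩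
  →e   : ∀ {Γ₁ Γ₂ U T M₁ M₂} →
         M₁ ⦂⟨ Γ₁ ⊢ ⌜ U ⇒ T ⌝ ⟩ → M₂ ⦂⟨ Γ₂ ⊢ U ⟩ →
         app M₁ M₂ ⦂⟨ Γ₁ ⊓ₑ Γ₂ ⊢ ⌜ T ⌝ ⟩
  ⊓i   : ∀ {Γ U₁ U₂ M} → M ⦂⟨ Γ ⊢ U₁ ⟩ → M ⦂⟨ Γ ⊢ U₂ ⟩ → M ⦂⟨ Γ ⊢ U₁ ⊓ U₂ ⟩
  sub  : ∀ {Γ Γ′ U U′ M} → M ⦂⟨ Γ ⊢ U ⟩ → Γ′ ⊑ₑ Γ → U ⊑ U′ → M ⦂⟨ Γ′ ⊢ U′ ⟩

module Submission where

-- Since typing environments declare exactly the free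
-- variables of the typed term, the right invariant is the restricted typing
-- N : ⟨Δ ↾ N ⊢ U⟩, and the proof is organised around it.

open import Data.Nat using (ℕ; zero; suc)
open import Data.Fin using (Fin; zero; suc; _≟_)
open import Data.Bool using (Bool; true; false; T; _∨_; if_then_else_)
open import Data.Bool.Properties using (T-∨; T-≡)
open import Data.Maybe using (Maybe; just; nothing)
open import Data.Product using (∃; _×_; _,_; proj₁; proj₂)
open import Data.Sum using (inj₁; inj₂)
open import Function using (_∘_)
open import Function.Bundles using (Equivalence)
open import Relation.Nullary using (yes; no)
open import Relation.Nullary.Decidable using (toWitness; fromWitness)
open import Relation.Binary.PropositionalEquality using (_≡_; refl; cong) renaming (subst to ≡-subst)
open import Relation.Binary.Construct.Closure.ReflexiveTransitive using (ε; _◅_)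
open import Defs

infix 4 _≤T_ _≤U_ _≤ᶜ_ _≼_ _⊩_⦂_

-- 1. Syntax-directed subtyping

mutual
  data _≤T_ : TT → TT → Set where
    ≤-atom : ∀ {a} → atom a ≤T atom a
    ≤-⇒    : ∀ {U₁ U₂ T₁ T₂} → U₂ ≤U U₁ → T₁ ≤T T₂ → U₁ ⇒ T₁ ≤T U₂ ⇒ T₂

  data _≤U_ : UU → UU → Set where
    ≤-ω   : ∀ {U} → U ≤U ω
    ≤-⊓   : ∀ {U V W} → U ≤U V → U ≤U W → U ≤U V ⊓ W
    ≤-⌜⌝  : ∀ {U T} → U ≤ᶜ T → U ≤U ⌜ T ⌝

  data _≤ᶜ_ : UU → TT → Set where
    here  : ∀ {T T′} → T ≤T T′ → ⌜ T ⌝ ≤ᶜ T′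
    left  : ∀ {U V T} → U ≤ᶜ T → U ⊓ V ≤ᶜ T
    right : ∀ {U V T} → V ≤ᶜ T → U ⊓ V ≤ᶜ T

mutual
  ≤T-refl : ∀ T → T ≤T T
  ≤T-refl (atom a) = ≤-atom
  ≤T-refl (U ⇒ T)  = ≤-⇒ (≤U-refl U) (≤T-refl T)

  ≤U-refl : ∀ U → U ≤U U
  ≤U-refl ω       = ≤-ω
  ≤U-refl (U ⊓ V) = ≤-⊓ (≤U-weakˡ (≤U-refl U)) (≤U-weakʳ (≤U-refl V))
  ≤U-refl ⌜ T ⌝   = ≤-⌜⌝ (here (≤T-refl T))

  ≤U-weakˡ : ∀ {U V W} → U ≤U W → U ⊓ V ≤U W
  ≤U-weakˡ ≤-ω       = ≤-ω
  ≤U-weakˡ (≤-⊓ p q) = ≤-⊓ (≤U-weakˡ p) (≤U-weakˡ q)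
  ≤U-weakˡ (≤-⌜⌝ c)  = ≤-⌜⌝ (left c)

  ≤U-weakʳ : ∀ {U V W} → V ≤U W → U ⊓ V ≤U W
  ≤U-weakʳ ≤-ω       = ≤-ω
  ≤U-weakʳ (≤-⊓ p q) = ≤-⊓ (≤U-weakʳ p) (≤U-weakʳ q)
  ≤U-weakʳ (≤-⌜⌝ c)  = ≤-⌜⌝ (right c)

-- Transitivity is admissible (cut elimination for the structural rules).
mutual
  ≤T-trans : ∀ {A B C} → A ≤T B → B ≤T C → A ≤T C
  ≤T-trans ≤-atom      ≤-atom        = ≤-atom
  ≤T-trans (≤-⇒ u t)   (≤-⇒ u′ t′)   = ≤-⇒ (≤U-trans u′ u) (≤T-trans t t′)

  ≤U-trans : ∀ {A B C} → A ≤U B → B ≤U C → A ≤U C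
  ≤U-trans p ≤-ω       = ≤-ω
  ≤U-trans p (≤-⊓ q r) = ≤-⊓ (≤U-trans p q) (≤U-trans p r)
  ≤U-trans p (≤-⌜⌝ c)  = ≤-⌜⌝ (≤ᶜ-pull p c)

  ≤ᶜ-pull : ∀ {A B T} → A ≤U B → B ≤ᶜ T → A ≤ᶜ T
  ≤ᶜ-pull (≤-⌜⌝ c)  (here t)  = ≤ᶜ-push c t
  ≤ᶜ-pull (≤-⊓ p q) (left c)  = ≤ᶜ-pull p c
  ≤ᶜ-pull (≤-⊓ p q) (right c) = ≤ᶜ-pull q c

  ≤ᶜ-push : ∀ {A T T′} → A ≤ᶜ T → T ≤T T′ → A ≤ᶜ T′
  ≤ᶜ-push (here t)  r = here (≤T-trans t r)
  ≤ᶜ-push (left c)  r = left (≤ᶜ-push c r)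
  ≤ᶜ-push (right c) r = right (≤ᶜ-push c r)

≤U-⌜⌝-inv : ∀ {T T′} → ⌜ T ⌝ ≤U ⌜ T′ ⌝ → T ≤T T′
≤U-⌜⌝-inv (≤-⌜⌝ (here t)) = t

≤U-⊓-mono : ∀ {U U′ V V′} → U ≤U U′ → V ≤U V′ → U ⊓ V ≤U U′ ⊓ V′
≤U-⊓-mono p q = ≤-⊓ (≤U-weakˡ p) (≤U-weakʳ q)

≅⇒≤ : ∀ {U V} → U ≅ V → (U ≤U V) × (V ≤U U)
≅⇒≤ {U} ≅-refl = ≤U-refl U , ≤U-refl U
≅⇒≤ (≅-sym e) = proj₂ (≅⇒≤ e) , proj₁ (≅⇒≤ e)
≅⇒≤ (≅-trans e f) =
  ≤U-trans (proj₁ (≅⇒≤ e)) (proj₁ (≅⇒≤ f)) , ≤U-trans (proj₂ (≅⇒≤ f)) (proj₂ (≅⇒≤ e))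
≅⇒≤ (⊓-comm {U} {V}) =
  ≤-⊓ (≤U-weakʳ (≤U-refl V)) (≤U-weakˡ (≤U-refl U)) ,
  ≤-⊓ (≤U-weakʳ (≤U-refl U)) (≤U-weakˡ (≤U-refl V))
≅⇒≤ (⊓-assoc {U} {V} {W}) =
  ≤-⊓ (≤U-weakˡ (≤U-weakˡ (≤U-refl U)))
      (≤-⊓ (≤U-weakˡ (≤U-weakʳ (≤U-refl V))) (≤U-weakʳ (≤U-refl W))) ,
  ≤-⊓ (≤-⊓ (≤U-weakˡ (≤U-refl U)) (≤U-weakʳ (≤U-weakˡ (≤U-refl V))))
      (≤U-weakʳ (≤U-weakʳ (≤U-refl W)))
≅⇒≤ (⊓-idem {U}) = ≤U-weakˡ (≤U-refl U) , ≤-⊓ (≤U-refl U) (≤U-refl U)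
≅⇒≤ (⊓-unit {U}) = ≤U-weakʳ (≤U-refl U) , ≤-⊓ ≤-ω (≤U-refl U)
≅⇒≤ (⊓-cong e f) =
  ≤U-⊓-mono (proj₁ (≅⇒≤ e)) (proj₁ (≅⇒≤ f)) , ≤U-⊓-mono (proj₂ (≅⇒≤ e)) (proj₂ (≅⇒≤ f))
≅⇒≤ (⇒-cong e f) =
  ≤-⌜⌝ (here (≤-⇒ (proj₂ (≅⇒≤ e)) (≤U-⌜⌝-inv (proj₁ (≅⇒≤ f))))) ,
  ≤-⌜⌝ (here (≤-⇒ (proj₁ (≅⇒≤ e)) (≤U-⌜⌝-inv (proj₂ (≅⇒≤ f)))))

⊑⇒≤ : ∀ {U V} → U ⊑ V → U ≤U V
⊑⇒≤ (⊑-refl e)         = proj₁ (≅⇒≤ e)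
⊑⇒≤ (⊑-trans p q)      = ≤U-trans (⊑⇒≤ p) (⊑⇒≤ q)
⊑⇒≤ {U₁ ⊓ U₂} ⊑-⊓      = ≤U-weakˡ (≤U-refl U₁)
⊑⇒≤ (⊑-⊓-mono p q)     = ≤U-⊓-mono (⊑⇒≤ p) (⊑⇒≤ q)
⊑⇒≤ (⊑-⇒ p q)          = ≤-⌜⌝ (here (≤-⇒ (⊑⇒≤ p) (≤U-⌜⌝-inv (⊑⇒≤ q))))

⊑-id : ∀ {U} → U ⊑ U
⊑-id = ⊑-refl ≅-refl

⊑-ω : ∀ {U} → U ⊑ ω
⊑-ω = ⊑-trans (⊑-refl (≅-sym ⊓-unit)) ⊑-⊓

⊑-⊓ʳ : ∀ {U V} → (U ⊓ V) ⊑ V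
⊑-⊓ʳ = ⊑-trans (⊑-refl ⊓-comm) ⊑-⊓

⊑-glb : ∀ {W U V} → W ⊑ U → W ⊑ V → W ⊑ (U ⊓ V)
⊑-glb a b = ⊑-trans (⊑-refl (≅-sym ⊓-idem)) (⊑-⊓-mono a b)

mutual
  ≤T⇒⊑ : ∀ {T T′} → T ≤T T′ → ⌜ T ⌝ ⊑ ⌜ T′ ⌝
  ≤T⇒⊑ ≤-atom    = ⊑-id
  ≤T⇒⊑ (≤-⇒ u t) = ⊑-⇒ (≤U⇒⊑ u) (≤T⇒⊑ t)

  ≤U⇒⊑ : ∀ {U V} → U ≤U V → U ⊑ V
  ≤U⇒⊑ ≤-ω       = ⊑-ω
  ≤U⇒⊑ (≤-⊓ a b) = ⊑-glb (≤U⇒⊑ a) (≤U⇒⊑ b)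
  ≤U⇒⊑ (≤-⌜⌝ c)  = ≤ᶜ⇒⊑ c

  ≤ᶜ⇒⊑ : ∀ {U T} → U ≤ᶜ T → U ⊑ ⌜ T ⌝
  ≤ᶜ⇒⊑ (here t)  = ≤T⇒⊑ t
  ≤ᶜ⇒⊑ (left c)  = ⊑-trans ⊑-⊓ (≤ᶜ⇒⊑ c)
  ≤ᶜ⇒⊑ (right c) = ⊑-trans ⊑-⊓ʳ (≤ᶜ⇒⊑ c)

-- 2. Free variables

data _∈fv_ {n : ℕ} (i : Fin n) : Tm n → Set where
  fv-var  : i ∈fv var i
  fv-lam  : ∀ {P} → suc i ∈fv P → i ∈fv lam P
  fv-appˡ : ∀ {A B} → i ∈fv A → i ∈fv app A B
  fv-appʳ : ∀ {A B} → i ∈fv B → i ∈fv app A B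

∈fv⇒occurs : ∀ {n} {i : Fin n} {M} → i ∈fv M → T (occurs i M)
∈fv⇒occurs {i = i} fv-var = fromWitness {a? = i ≟ i} refl
∈fv⇒occurs (fv-lam o) = ∈fv⇒occurs o
∈fv⇒occurs {i = i} (fv-appˡ {A} {B} o) =
  Equivalence.from (T-∨ {occurs i A} {occurs i B}) (inj₁ (∈fv⇒occurs o))
∈fv⇒occurs {i = i} (fv-appʳ {A} {B} o) =
  Equivalence.from (T-∨ {occurs i A} {occurs i B}) (inj₂ (∈fv⇒occurs o))

occurs⇒∈fv : ∀ {n} {i : Fin n} M → T (occurs i M) → i ∈fv M
occurs⇒∈fv {i = i} (var j) o with refl ← toWitness {a? = i ≟ j} o = fv-var
occurs⇒∈fv (lam P) o = fv-lam (occurs⇒∈fv P o)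
occurs⇒∈fv {i = i} (app A B) o with Equivalence.to (T-∨ {occurs i A} {occurs i B}) o
... | inj₁ a = fv-appˡ (occurs⇒∈fv A a)
... | inj₂ b = fv-appʳ (occurs⇒∈fv B b)

∈fv-rename : ∀ {m n} (ρ : Fin m → Fin n) (M : Tm m) {i} → i ∈fv rename ρ M →
             ∃ λ j → ρ j ≡ i × j ∈fv M
∈fv-rename ρ (var k) fv-var = k , refl , fv-var
∈fv-rename ρ (lam P) (fv-lam o) with ∈fv-rename (ext ρ) P o
... | zero  , () , _
... | suc j , refl , o′ = j , refl , fv-lam o′
∈fv-rename ρ (app A B) (fv-appˡ o) = let j , e , o′ = ∈fv-rename ρ A o in j , e , fv-appˡ o′
∈fv-rename ρ (app A B) (fv-appʳ o) = let j , e , o′ = ∈fv-rename ρ B o in j , e , fv-appʳ o′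

∈fv-subst : ∀ {m n} (σ : Fin m → Tm n) (M : Tm m) {i} → i ∈fv subst σ M →
            ∃ λ j → j ∈fv M × i ∈fv σ j
∈fv-subst σ (var k) o = k , fv-var , o
∈fv-subst σ (lam P) (fv-lam o) with ∈fv-subst (exts σ) P o
... | zero  , _  , ()
... | suc j , o₁ , o₂ with ∈fv-rename suc (σ j) o₂
...   | _ , refl , o₂′ = j , fv-lam o₁ , o₂′
∈fv-subst σ (app A B) (fv-appˡ o) = let j , o₁ , o₂ = ∈fv-subst σ A o in j , fv-appˡ o₁ , o₂
∈fv-subst σ (app A B) (fv-appʳ o) = let j , o₁ , o₂ = ∈fv-subst σ B o in j , fv-appʳ o₁ , o₂

∈fv-▷β : ∀ {n} {M N : Tm n} → M ▷β N → ∀ {i} → i ∈fv N → i ∈fv M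
∈fv-▷β (β {M = P} {N = Q}) o with ∈fv-subst (subst₀ Q) P o
... | zero  , _  , o₂     = fv-appʳ o₂
... | suc j , o₁ , fv-var = fv-appˡ (fv-lam o₁)
∈fv-▷β (ξlam r)  (fv-lam o)  = fv-lam (∈fv-▷β r o)
∈fv-▷β (ξappˡ r) (fv-appˡ o) = fv-appˡ (∈fv-▷β r o)
∈fv-▷β (ξappˡ r) (fv-appʳ o) = fv-appʳ o
∈fv-▷β (ξappʳ r) (fv-appˡ o) = fv-appˡ o
∈fv-▷β (ξappʳ r) (fv-appʳ o) = fv-appʳ (∈fv-▷β r o)

-- 3. Environments

⊑ₘ-id : ∀ m → m ⊑ₘ m
⊑ₘ-id nothing  = nothing⊑
⊑ₘ-id (just U) = just⊑ ⊑-id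

⊑ₑ-id : ∀ {n} {Γ : Env n} → Γ ⊑ₑ Γ
⊑ₑ-id {Γ = Γ} i = ⊑ₘ-id (Γ i)

⊑ₘ-≡ : ∀ {m W} → m ≡ just W → m ⊑ₘ just W
⊑ₘ-≡ refl = just⊑ ⊑-id

⊑ₘ-just-inv : ∀ {m W} → m ⊑ₘ just W → ∃ λ V → m ≡ just V × V ⊑ W
⊑ₘ-just-inv (just⊑ p) = _ , refl , p

⊑ₘ-weaken : ∀ {m V W} → m ⊑ₘ just V → V ⊑ W → m ⊑ₘ just W
⊑ₘ-weaken (just⊑ q) p = just⊑ (⊑-trans q p)

_≼_ : ∀ {n} → Env n → Env n → Set
Γ ≼ Δ = ∀ i {W} → Γ i ≡ just W → Δ i ⊑ₘ just W

≼-refl : ∀ {n} {Γ : Env n} → Γ ≼ Γ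
≼-refl i = ⊑ₘ-≡

≼-trans : ∀ {n} {Γ₁ Γ₂ Γ₃ : Env n} → Γ₁ ≼ Γ₂ → Γ₂ ≼ Γ₃ → Γ₁ ≼ Γ₃
≼-trans h₁ h₂ i e with ⊑ₘ-just-inv (h₁ i e)
... | _ , e′ , p = ⊑ₘ-weaken (h₂ i e′) p

⊑ₑ⇒≼ : ∀ {n} {Γ Γ′ : Env n} → Γ′ ⊑ₑ Γ → Γ ≼ Γ′
⊑ₑ⇒≼ {Γ′ = Γ′} pw i e = ≡-subst (Γ′ i ⊑ₘ_) e (pw i)

⊓ₑ-≼ˡ : ∀ {n} {Γ₁ Γ₂ : Env n} → Γ₁ ≼ Γ₁ ⊓ₑ Γ₂
⊓ₑ-≼ˡ {Γ₁ = Γ₁} {Γ₂} i e with Γ₁ i | Γ₂ i | e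
... | just U | just V  | refl = just⊑ ⊑-⊓
... | just U | nothing | refl = just⊑ ⊑-id

⊓ₑ-≼ʳ : ∀ {n} {Γ₁ Γ₂ : Env n} → Γ₂ ≼ Γ₁ ⊓ₑ Γ₂
⊓ₑ-≼ʳ {Γ₁ = Γ₁} {Γ₂} i e with Γ₁ i | Γ₂ i | e
... | just U  | just V | refl = just⊑ ⊑-⊓ʳ
... | nothing | just V | refl = just⊑ ⊑-id

↾-≼ : ∀ {n} {Γ : Env n} (N : Tm n) → Γ ↾ N ≼ Γ
↾-≼ N i e with occurs i N
... | true = ⊑ₘ-≡ e

envω-≼ : ∀ {n} {Δ : Env n} {N : Tm n} → (∀ i → i ∈fv N → Δ i ⊑ₘ just ω) → envω N ≼ Δ
envω-≼ {N = N} h i e with occurs i N in o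
envω-≼ {N = N} h i refl | true = h i (occurs⇒∈fv N (Equivalence.from T-≡ o))

≼-envω : ∀ {n} {Δ : Env n} {N : Tm n} → envω N ≼ Δ → ∀ i → i ∈fv N → Δ i ⊑ₘ just ω
≼-envω {N = N} h i o with occurs i N | h i | ∈fv⇒occurs o
... | true | h′ | _ = h′ refl

data Declared : Bool → Maybe UU → Set where
  declared   : ∀ {V} → Declared true (just V)
  undeclared : Declared false nothing

Declared-⊑ : ∀ {b m m′} → Declared b m → m′ ⊑ₘ m → Declared b m′
Declared-⊑ declared   (just⊑ _) = declared
Declared-⊑ undeclared nothing⊑  = undeclared

Declared-⊓ : ∀ {n a b} (Γ₁ Γ₂ : Env n) i →
             Declared a (Γ₁ i) → Declared b (Γ₂ i) → Declared (a ∨ b) ((Γ₁ ⊓ₑ Γ₂) i)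
Declared-⊓ Γ₁ Γ₂ i p q with Γ₁ i | Γ₂ i
Declared-⊓ Γ₁ Γ₂ i declared   declared   | just _  | just _  = declared
Declared-⊓ Γ₁ Γ₂ i declared   undeclared | just _  | nothing = declared
Declared-⊓ Γ₁ Γ₂ i undeclared declared   | nothing | just _  = declared
Declared-⊓ Γ₁ Γ₂ i undeclared undeclared | nothing | nothing = undeclared

dom-fv : ∀ {n} {Γ : Env n} {M U} → M ⦂⟨ Γ ⊢ U ⟩ → ∀ i → Declared (occurs i M) (Γ i)
dom-fv (ax x T) i with i ≟ x
... | yes _ = declared
... | no _  = undeclared
dom-fv (ω-ty M) i with occurs i M
... | true  = declared
... | false = undeclared
dom-fv (→i d)  i = dom-fv d (suc i)
dom-fv (→i′ d) i = dom-fv d (suc i)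
dom-fv (→e {Γ₁ = Γ₁} {Γ₂} d₁ d₂) i = Declared-⊓ Γ₁ Γ₂ i (dom-fv d₁ i) (dom-fv d₂ i)
dom-fv (⊓i d₁ d₂)   i = dom-fv d₁ i
dom-fv (sub d pw s) i = Declared-⊑ (dom-fv d i) (pw i)

fv⊆dom : ∀ {n} {Γ : Env n} {M U} → M ⦂⟨ Γ ⊢ U ⟩ → envω M ≼ Γ
fv⊆dom {M = M} d = envω-≼ {N = M} λ i o → at (dom-fv d i) (∈fv⇒occurs o)
  where
  at : ∀ {b m} → Declared b m → T b → m ⊑ₘ just ω
  at declared _ = just⊑ ⊑-ω

restrict : ∀ {n} {Γ Δ : Env n} {M U} → M ⦂⟨ Γ ⊢ U ⟩ → Γ ≼ Δ → M ⦂⟨ Δ ↾ M ⊢ U ⟩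
restrict {Δ = Δ} d h = sub d (λ i → at (Δ i) (dom-fv d i) (h i)) ⊑-id
  where
  at : ∀ {b m} (m′ : Maybe UU) → Declared b m → (∀ {W} → m ≡ just W → m′ ⊑ₘ just W) →
       (if b then m′ else nothing) ⊑ₘ m
  at m′ declared   h′ = h′ refl
  at m′ undeclared h′ = nothing⊑

-- 4. Restricted typings: typing rules, renaming and substitution

single-self : ∀ {n} (x : Fin n) U → single x U x ≡ just U
single-self x U =
  cong (if_then just U else nothing) (Equivalence.to T-≡ (∈fv⇒occurs (fv-var {i = x})))

single-⊑ : ∀ {n} (x : Fin n) {U V} → U ⊑ V → single x U ⊑ₑ single x V
single-⊑ x p i with i ≟ x
... | yes _ = just⊑ p
... | no _  = nothing⊑

var-any : ∀ {n} (x : Fin n) U → var x ⦂⟨ single x U ⊢ U ⟩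
var-any x ω         = sub (ω-ty (var x)) (λ i → ⊑ₘ-id (single x ω i)) ⊑-id
var-any x (U₁ ⊓ U₂) = ⊓i (sub (var-any x U₁) (single-⊑ x ⊑-⊓) ⊑-id)
                         (sub (var-any x U₂) (single-⊑ x ⊑-⊓ʳ) ⊑-id)
var-any x ⌜ T ⌝     = ax x T

var-↾ : ∀ {n} {Δ : Env n} {j W} → Δ j ⊑ₘ just W → var j ⦂⟨ Δ ↾ var j ⊢ W ⟩
var-↾ {Δ = Δ} {j} {W} h = sub (var-any j W) pw ⊑-id
  where
  pw : (Δ ↾ var j) ⊑ₑ single j W
  pw i with i ≟ j
  ... | yes refl = h
  ... | no _     = nothing⊑

-- application rule for restricted typings; (Δ ↾ A) ⊓ₑ (Δ ↾ B) is Δ ↾ AB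
-- up to idempotence of ⊓
app-↾ : ∀ {n} {Δ : Env n} {A B U T} →
        A ⦂⟨ Δ ↾ A ⊢ ⌜ U ⇒ T ⌝ ⟩ → B ⦂⟨ Δ ↾ B ⊢ U ⟩ → app A B ⦂⟨ Δ ↾ app A B ⊢ ⌜ T ⌝ ⟩
app-↾ {Δ = Δ} {A} {B} a b = sub (→e a b) pw ⊑-id
  where
  pw : (Δ ↾ app A B) ⊑ₑ ((Δ ↾ A) ⊓ₑ (Δ ↾ B))
  pw i with occurs i A | occurs i B | Δ i
  ... | true  | true  | just V  = just⊑ (⊑-refl (≅-sym ⊓-idem))
  ... | true  | false | just V  = just⊑ ⊑-id
  ... | false | true  | just V  = just⊑ ⊑-id
  ... | true  | true  | nothing = nothing⊑
  ... | true  | false | nothing = nothing⊑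
  ... | false | true  | nothing = nothing⊑
  ... | false | false | _       = nothing⊑

if-true : ∀ {b} {m : Maybe UU} → b ≡ true → m ⊑ₘ (if b then m else nothing)
if-true {m = m} refl = ⊑ₘ-id m

if-false : ∀ {b} {m : Maybe UU} → b ≡ false → nothing ⊑ₘ (if b then m else nothing)
if-false refl = nothing⊑

▸-↾ : ∀ {n} {Δ : Env n} {u u′} (P : Tm (suc n)) → u ⊑ₘ ((Δ ▸ u′) ↾ P) zero →
      ((Δ ↾ lam P) ▸ u) ⊑ₑ ((Δ ▸ u′) ↾ P)
▸-↾ P c zero = c
▸-↾ {Δ = Δ} P c (suc i) = ⊑ₘ-id ((Δ ↾ lam P) i)

-- λ-introduction for restricted typings: rule →i if the bound variable
-- occurs in the body, otherwise →i′ followed by ω ⇒ T ⊑ U ⇒ T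
lam-↾ : ∀ {n} {Δ : Env n} {P U T} →
        P ⦂⟨ (Δ ▸ just U) ↾ P ⊢ ⌜ T ⌝ ⟩ → lam P ⦂⟨ Δ ↾ lam P ⊢ ⌜ U ⇒ T ⌝ ⟩
lam-↾ {P = P} d with occurs zero P in o
... | true  = →i (sub d (▸-↾ P (if-true o)) ⊑-id)
... | false = sub (→i′ (sub d (▸-↾ P (if-false o)) ⊑-id)) ⊑ₑ-id (⊑-⇒ ⊑-ω ⊑-id)

lam-↾′ : ∀ {n} {Δ : Env n} {P T} →
         P ⦂⟨ (Δ ▸ nothing) ↾ P ⊢ ⌜ T ⌝ ⟩ → lam P ⦂⟨ Δ ↾ lam P ⊢ ⌜ ω ⇒ T ⌝ ⟩
lam-↾′ {P = P} d with occurs zero P in o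
... | true  = →i′ (sub d (▸-↾ P (if-true o)) ⊑-id)
... | false = →i′ (sub d (▸-↾ P (if-false o)) ⊑-id)

▸-≼ : ∀ {m n} {Γ : Env m} {Δ : Env n} {ρ : Fin m → Fin n} (u : Maybe UU) →
      Γ ≼ Δ ∘ ρ → Γ ▸ u ≼ (Δ ▸ u) ∘ ext ρ
▸-≼ u h zero    = ⊑ₘ-≡
▸-≼ u h (suc i) = h i

envω-rename : ∀ {m n} {Δ : Env n} (ρ : Fin m → Fin n) (M : Tm m) →
              envω M ≼ Δ ∘ ρ → envω (rename ρ M) ≼ Δ
envω-rename {Δ = Δ} ρ M h = envω-≼ {N = rename ρ M} λ i o →
  let j , ρj≡i , o′ = ∈fv-rename ρ M o
  in ≡-subst (λ k → Δ k ⊑ₘ just ω) ρj≡i (≼-envω {N = M} h j o′)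

rename-↾ : ∀ {m n} {Γ : Env m} {Δ : Env n} {M U} (ρ : Fin m → Fin n) →
           M ⦂⟨ Γ ⊢ U ⟩ → Γ ≼ Δ ∘ ρ → rename ρ M ⦂⟨ Δ ↾ rename ρ M ⊢ U ⟩
rename-↾ ρ (ax x T)     h = var-↾ (h x (single-self x ⌜ T ⌝))
rename-↾ ρ (ω-ty M)     h = restrict (ω-ty (rename ρ M)) (envω-rename ρ M h)
rename-↾ ρ (→i d)       h = lam-↾ (rename-↾ (ext ρ) d (▸-≼ _ h))
rename-↾ ρ (→i′ d)      h = lam-↾′ (rename-↾ (ext ρ) d (▸-≼ _ h))
rename-↾ ρ (→e d₁ d₂)   h = app-↾ (rename-↾ ρ d₁ (≼-trans ⊓ₑ-≼ˡ h))
                                  (rename-↾ ρ d₂ (≼-trans ⊓ₑ-≼ʳ h))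
rename-↾ ρ (⊓i d₁ d₂)   h = ⊓i (rename-↾ ρ d₁ h) (rename-↾ ρ d₂ h)
rename-↾ ρ (sub d pw s) h = sub (rename-↾ ρ d (≼-trans (⊑ₑ⇒≼ pw) h)) ⊑ₑ-id s

_⊩_⦂_ : ∀ {m n} → Env n → (Fin m → Tm n) → Env m → Set
Δ ⊩ σ ⦂ Γ = ∀ j {W} → Γ j ≡ just W → σ j ⦂⟨ Δ ↾ σ j ⊢ W ⟩

⊩-≼ : ∀ {m n} {Γ Γ′ : Env m} {Δ : Env n} {σ} → Γ′ ≼ Γ → Δ ⊩ σ ⦂ Γ → Δ ⊩ σ ⦂ Γ′
⊩-≼ c h j e with ⊑ₘ-just-inv (c j e)
... | _ , e′ , p = sub (h j e′) ⊑ₑ-id p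

⊩-exts : ∀ {m n} {Γ : Env m} {Δ : Env n} {σ : Fin m → Tm n} (u : Maybe UU) →
         Δ ⊩ σ ⦂ Γ → (Δ ▸ u) ⊩ exts σ ⦂ (Γ ▸ u)
⊩-exts u h zero    e = var-↾ (⊑ₘ-≡ e)
⊩-exts {σ = σ} u h (suc j) e = rename-↾ suc (h j e) (↾-≼ (σ j))

envω-subst : ∀ {m n} {Δ : Env n} (σ : Fin m → Tm n) (M : Tm m) →
             Δ ⊩ σ ⦂ envω M → envω (subst σ M) ≼ Δ
envω-subst {Δ = Δ} σ M h = envω-≼ {N = subst σ M} λ i o →
  let j , o₁ , o₂ = ∈fv-subst σ M o
      σj-typed    = h j (envω-at o₁)
  in ≼-envω {N = σ j} (≼-trans (fv⊆dom σj-typed) (↾-≼ {Γ = Δ} (σ j))) i o₂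
  where
  envω-at : ∀ {j} → j ∈fv M → envω M j ≡ just ω
  envω-at {j} o with occurs j M | ∈fv⇒occurs o
  ... | true | _ = refl

subst-↾ : ∀ {m n} {Γ : Env m} {Δ : Env n} {M U} (σ : Fin m → Tm n) →
          M ⦂⟨ Γ ⊢ U ⟩ → Δ ⊩ σ ⦂ Γ → subst σ M ⦂⟨ Δ ↾ subst σ M ⊢ U ⟩
subst-↾ σ (ax x T)     h = h x (single-self x ⌜ T ⌝)
subst-↾ σ (ω-ty M)     h = restrict (ω-ty (subst σ M)) (envω-subst σ M h)
subst-↾ σ (→i d)       h = lam-↾ (subst-↾ (exts σ) d (⊩-exts _ h))
subst-↾ σ (→i′ d)      h = lam-↾′ (subst-↾ (exts σ) d (⊩-exts _ h))
subst-↾ σ (→e d₁ d₂)   h = app-↾ (subst-↾ σ d₁ (⊩-≼ ⊓ₑ-≼ˡ h)) (subst-↾ σ d₂ (⊩-≼ ⊓ₑ-≼ʳ h))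
subst-↾ σ (⊓i d₁ d₂)   h = ⊓i (subst-↾ σ d₁ h) (subst-↾ σ d₂ h)
subst-↾ σ (sub d pw s) h = sub (subst-↾ σ d (⊩-≼ (⊑ₑ⇒≼ pw) h)) ⊑ₑ-id s

-- 5. Subject reduction

▸-⊑ₑ : ∀ {n} {Γ Γ′ : Env n} (u : Maybe UU) → Γ′ ⊑ₑ Γ → (Γ′ ▸ u) ⊑ₑ (Γ ▸ u)
▸-⊑ₑ u pw zero    = ⊑ₘ-id u
▸-⊑ₑ u pw (suc i) = pw i

lam-gen : ∀ {n} {Γ : Env n} {P W U T} → lam P ⦂⟨ Γ ⊢ W ⟩ → W ≤ᶜ U ⇒ T →
          ∃ λ u → P ⦂⟨ Γ ▸ u ⊢ ⌜ T ⌝ ⟩ × (∀ {V} → u ≡ just V → U ⊑ V)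
lam-gen (ω-ty _) ()
lam-gen (→i d)  (here (≤-⇒ u t)) = _ , sub d ⊑ₑ-id (≤T⇒⊑ t) , λ { refl → ≤U⇒⊑ u }
lam-gen (→i′ d) (here (≤-⇒ u t)) = nothing , sub d ⊑ₑ-id (≤T⇒⊑ t) , λ ()
lam-gen (⊓i d₁ d₂) (left c)  = lam-gen d₁ c
lam-gen (⊓i d₁ d₂) (right c) = lam-gen d₂ c
lam-gen (sub d pw s) c =
  let u , dP , accepts = lam-gen d (≤ᶜ-pull (⊑⇒≤ s) c)
  in u , sub dP (▸-⊑ₑ u pw) ⊑-id , accepts

⊩-subst₀ : ∀ {n} {Γ Δ : Env n} {Q : Tm n} {u : Maybe UU} → Γ ≼ Δ →
           (∀ {W} → u ≡ just W → Q ⦂⟨ Δ ↾ Q ⊢ W ⟩) → Δ ⊩ subst₀ Q ⦂ (Γ ▸ u)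
⊩-subst₀ c q zero    e = q e
⊩-subst₀ c q (suc j) e = var-↾ (c j e)

-- A contracted redex is handled by generation for the λ and the
-- substitution lemma; in a reduced application the untouched side is restricted
-- back into the meet; a ω-typing survives as reduction creates no free variables.
subject-reduction : ∀ {n} {Γ : Env n} {M N U} → M ⦂⟨ Γ ⊢ U ⟩ → M ▷β N → N ⦂⟨ Γ ↾ N ⊢ U ⟩
subject-reduction (ax x T) ()
subject-reduction {N = N} (ω-ty M) r =
  restrict (ω-ty N) (envω-≼ {N = N} λ i o → ≼-envω {N = M} ≼-refl i (∈fv-▷β r o))
subject-reduction (→i d)  (ξlam r) = lam-↾ (subject-reduction d r)
subject-reduction (→i′ d) (ξlam r) = lam-↾′ (subject-reduction d r)
subject-reduction (→e {U = U} {T} d₁ d₂) (β {M = P} {N = Q}) =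
  let u , dP , accepts = lam-gen d₁ (here (≤T-refl (U ⇒ T)))
  in subst-↾ (subst₀ Q) dP
       (⊩-subst₀ ⊓ₑ-≼ˡ λ e → restrict (sub d₂ ⊑ₑ-id (accepts e)) ⊓ₑ-≼ʳ)
subject-reduction (→e d₁ d₂) (ξappˡ {M′ = A′} r) =
  app-↾ (restrict (subject-reduction d₁ r) (≼-trans (↾-≼ A′) ⊓ₑ-≼ˡ)) (restrict d₂ ⊓ₑ-≼ʳ)
subject-reduction (→e d₁ d₂) (ξappʳ {N′ = B′} r) =
  app-↾ (restrict d₁ ⊓ₑ-≼ˡ) (restrict (subject-reduction d₂ r) (≼-trans (↾-≼ B′) ⊓ₑ-≼ʳ))
subject-reduction (⊓i d₁ d₂) r = ⊓i (subject-reduction d₁ r) (subject-reduction d₂ r)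
subject-reduction {N = N} (sub d pw s) r =
  restrict (sub (subject-reduction d r) ⊑ₑ-id s) (≼-trans (↾-≼ N) (⊑ₑ⇒≼ pw))

corollary3p6 : ∀ {n : ℕ} {Γ : Env n} {M N : Tm n} {U : UU} →
    M ⦂⟨ Γ ⊢ U ⟩ → M ▷β* N → N ⦂⟨ Γ ↾ N ⊢ U ⟩
corollary3p6 d ε = restrict d ≼-refl
corollary3p6 {N = N} d (_◅_ {j = N₁} r rs) =
  restrict (corollary3p6 (subject-reduction d r) rs) (≼-trans (↾-≼ N) (↾-≼ N₁))
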